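{- For every $n\ge 0$, the map $\phi$ is a bijection from the set of Motzkin paths of length $2n+1$ to the set of paths in $\mathcal{A}^{Q}$ of horizontal length $n$, and also from the set of Grand Motzkin paths of length $2n+1$ to the set of paths in $\mathcal{A}^{H}$ of horizontal length $n$; its inverse is $\psi$.
   Context: A lattice path is a finite sequence of steps (vectors in $\mathbb{Z}^2$) starting at $(0,0)$; its vertices are the partial sums. Let $S_{M}=\{(1,0),(1,1),(1,-1)\}$ and $S_{MW}=S_M\cup\{(0,1),(0,-1)\}$; $(0,\pm1)$ are vertical steps. A Grand Motzkin path of length $L$ is a lattice path of $L$ steps from $S_M$ (any endpoint); a Motzkin path of length $L$ is a Grand Motzkin path of length $L$ all of whose vertices have $y\ge0$. A vertically constrained $S_{MW}$ path is a lattice path with steps in $S_{MW}$ with no two consecutive vertical steps; its horizontal length is the $x$-coordinate of its endpoint. $\mathcal{A}^{H}$ is the set of all vertically constrained $S_{MW}$ paths, and $\mathcal{A}^{Q}$ the subset of those all of whose vertices have $y\ge 0$. The map $\phi$ acts on a path with steps $e_1,\dots,e_{2n+1}$ by modifying each step $e_i$ with $i$ odd: $(1,1)\mapsto(0,1)$, $(1,-1)\mapsto(0,-1)$, and $(1,0)$ is deleted; steps with even index are kept. The map $\psi$ acts on a vertically constrained $S_{MW}$ path of horizontal length $n$ as follows: for each $i\in\{0,1,\dots,n\}$ (there is at most one vertical step at $x$-coordinate $i$), if there is a vertical step at $x=i$, replace $(0,1)$ by $(1,1)$ and $(0,-1)$ by $(1,-1)$; otherwise insert a step $(1,0)$ at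 the vertex with $x$-coordinate $i$ (subsequent steps being shifted accordingly). -}

module Defs where

open import Data.Nat using (ℕ; zero; suc; _+_; _*_)
open import Data.Integer using (ℤ; +_; -[1+_]) renaming (_+_ to _+ℤ_; _≤_ to _≤ℤ_)
open import Data.List using (List; []; _∷_; _++_; length)
open import Data.List.Relation.Unary.All using (All)
open import Data.Product using (_×_)
open import Data.Unit using (⊤)
open import Data.Empty using (⊥)
open import Relation.Binary.PropositionalEquality using (_≡_)

data Step : Set where
  E U D N S : Step

dx : Step → ℕ
dx E = 1
dx U = 1
dx D = 1
dx N = 0
dx S = 0

dy : Step → ℤ
dy E = + 0
dy U = + 1
dy D = -[1+ 0 ]
dy N = + 1
dy S = -[1+ 0 ]

-- A lattice path is a list of steps, starting at (0,0).
Path : Set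
Path = List Step

InSM : Step → Set
InSM E = ⊤
InSM U = ⊤
InSM D = ⊤
InSM N = ⊥
InSM S = ⊥

IsVertical : Step → Set
IsVertical N = ⊤
IsVertical S = ⊤
IsVertical _ = ⊥

NonnegFrom : ℤ → Path → Set
NonnegFrom h [] = + 0 ≤ℤ h
NonnegFrom h (s ∷ ss) = (+ 0 ≤ℤ h) × NonnegFrom (h +ℤ dy s) ss

Nonneg : Path → Set
Nonneg = NonnegFrom (+ 0)

GrandMotzkin : ℕ → Path → Set
GrandMotzkin L p = All InSM p × length p ≡ L

Motzkin : ℕ → Path → Set
Motzkin L p = GrandMotzkin L p × Nonneg p

NoTwoVertical : Path → Set
NoTwoVertical [] = ⊤
NoTwoVertical (s ∷ []) = ⊤
NoTwoVertical (s ∷ t ∷ ss) = ((IsVertical s × IsVertical t) → ⊥) × NoTwoVertical (t ∷ ss)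

hlen : Path → ℕ
hlen [] = 0
hlen (s ∷ ss) = dx s + hlen ss

-- vertically constrained S_MW paths (every Step is in S_MW by construction)
-- of horizontal length n
AH : ℕ → Path → Set
AH n p = NoTwoVertical p × hlen p ≡ n

AQ : ℕ → Path → Set
AQ n p = AH n p × Nonneg p

-- the map φ: steps at odd (1-based) positions are modified,
-- steps at even positions are kept
modOdd : Step → List Step
modOdd U = N ∷ []
modOdd D = S ∷ []
modOdd E = []
modOdd N = N ∷ []   -- not reached on S_M paths
modOdd S = S ∷ []   -- not reached on S_M paths

mutual
  φodd : Path → Path
  φodd [] = []
  φodd (e ∷ es) = modOdd e ++ φeven es

  φeven : Path → Path
  φeven [] = []
  φeven (e ∷ es) = e ∷ φodd es

φ : Path → Path
φ = φodd

-- the map ψ: process x-coordinates 0,1,...,n in order.  At the vertex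
-- with x-coordinate i the path either takes a (unique) vertical step,
-- which is replaced by the corresponding diagonal step, or not, in which
-- case a step (1,0) is inserted; then the (horizontal-moving) step from
-- x = i to x = i+1 (if any) is kept.
diag : Step → Step
diag N = U
diag S = D
diag s = s

mutual
  ψat : Path → Path                 -- at the first vertex with a new x-coordinate
  ψat (N ∷ ps) = U ∷ ψafter ps
  ψat (S ∷ ps) = D ∷ ψafter ps
  ψat (E ∷ ps) = E ∷ ψafter (E ∷ ps)
  ψat (U ∷ ps) = E ∷ ψafter (U ∷ ps)
  ψat (D ∷ ps) = E ∷ ψafter (D ∷ ps)
  ψat [] = E ∷ []

  ψafter : Path → Path
  ψafter [] = []
  ψafter (p ∷ ps) = p ∷ ψat ps

ψ : Path → Path
ψ = ψat

-- Read an S_M path of length 2n+1 as n pairs (e, f) followed by a last step.  φ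
-- turns e into a vertical step or nothing and keeps f, which is horizontal; so the
-- image has horizontal length n and its vertical steps are separated by the f's.
-- Conversely ψ rebuilds each pair from a column "optional vertical step, then a
-- horizontal step", and the two maps undo each other column by column.  Both maps
-- only delete or insert flat steps and exchange diagonal and vertical steps of the
-- same height change, so the heights visited are unchanged and y ≥ 0 is preserved.
module Submission where

open import Defs
open import Data.Nat using (ℕ; zero; suc; _+_; _*_)
open import Data.Nat.Properties using (*-suc; suc-injective)
open import Data.Integer using (+_) renaming (_+_ to _+ℤ_; _≤_ to _≤ℤ_)
open import Data.Integer.Properties using (+-identityʳ)
open import Data.List using ([]; _∷_; _++_)
open import Data.List.Relation.Unary.All using ([]; _∷_)
open import Data.Product using (_×_; _,_)
open import Data.Unit using (tt)
open import Relation.Nullary using (¬_)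
open import Relation.Binary.PropositionalEquality
  using (_≡_; refl; sym; trans; cong; cong₂; subst)

InSM⇒¬IsVertical : ∀ {s} → InSM s → ¬ IsVertical s
InSM⇒¬IsVertical {N} ()
InSM⇒¬IsVertical {S} ()

¬IsVertical⇒InSM : ∀ s → ¬ IsVertical s → InSM s
¬IsVertical⇒InSM E _ = tt
¬IsVertical⇒InSM U _ = tt
¬IsVertical⇒InSM D _ = tt
¬IsVertical⇒InSM N ¬v with () ← ¬v tt
¬IsVertical⇒InSM S ¬v with () ← ¬v tt

InSM⇒dx≡1 : ∀ {s} → InSM s → dx s ≡ 1
InSM⇒dx≡1 {E} _ = refl
InSM⇒dx≡1 {U} _ = refl
InSM⇒dx≡1 {D} _ = refl

data OddSM : ℕ → Path → Set where
  [_]  : ∀ {e} → InSM e → OddSM 0 (e ∷ [])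
  cons : ∀ {n e f r} → InSM e → InSM f → OddSM n r → OddSM (suc n) (e ∷ f ∷ r)

2[1+n]+1≡2+[2n+1] : ∀ n → 2 * suc n + 1 ≡ 2 + (2 * n + 1)
2[1+n]+1≡2+[2n+1] n = cong (_+ 1) (*-suc 2 n)

oddSM⇒grandMotzkin : ∀ {n p} → OddSM n p → GrandMotzkin (2 * n + 1) p
oddSM⇒grandMotzkin [ i ] = i ∷ [] , refl
oddSM⇒grandMotzkin {suc n} (cons i j o) with oddSM⇒grandMotzkin o
... | all , len = i ∷ j ∷ all , trans (cong (λ k → 2 + k) len) (sym (2[1+n]+1≡2+[2n+1] n))

grandMotzkin⇒oddSM : ∀ n p → GrandMotzkin (2 * n + 1) p → OddSM n p
grandMotzkin⇒oddSM zero (e ∷ []) (i ∷ [] , _) = [ i ]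
grandMotzkin⇒oddSM (suc n) p (all , len) with trans len (2[1+n]+1≡2+[2n+1] n)
grandMotzkin⇒oddSM (suc n) (e ∷ f ∷ r) (i ∷ j ∷ all , _) | len =
  cons i j (grandMotzkin⇒oddSM n r (all , suc-injective (suc-injective len)))

∷-noTwoVertical : ∀ {f} r → InSM f → NoTwoVertical r → NoTwoVertical (f ∷ r)
∷-noTwoVertical []      _ _   = tt
∷-noTwoVertical (_ ∷ _) j ntv = (λ (v , _) → InSM⇒¬IsVertical j v) , ntv

modOdd-++-noTwoVertical : ∀ e {f r} → InSM f → NoTwoVertical (f ∷ r) →
                          NoTwoVertical (modOdd e ++ f ∷ r)
modOdd-++-noTwoVertical E _ ntv = ntv
modOdd-++-noTwoVertical U j ntv = (λ (_ , v) → InSM⇒¬IsVertical j v) , ntv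
modOdd-++-noTwoVertical D j ntv = (λ (_ , v) → InSM⇒¬IsVertical j v) , ntv
modOdd-++-noTwoVertical N j ntv = (λ (_ , v) → InSM⇒¬IsVertical j v) , ntv
modOdd-++-noTwoVertical S j ntv = (λ (_ , v) → InSM⇒¬IsVertical j v) , ntv

hlen-modOdd-++ : ∀ e ys → hlen (modOdd e ++ ys) ≡ hlen ys
hlen-modOdd-++ E _ = refl
hlen-modOdd-++ U _ = refl
hlen-modOdd-++ D _ = refl
hlen-modOdd-++ N _ = refl
hlen-modOdd-++ S _ = refl

φ-noTwoVertical : ∀ {n p} → OddSM n p → NoTwoVertical (φ p)
φ-noTwoVertical ([_] {E} _) = tt
φ-noTwoVertical ([_] {U} _) = tt
φ-noTwoVertical ([_] {D} _) = tt
φ-noTwoVertical (cons {e = e} {r = r} _ j o) =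
  modOdd-++-noTwoVertical e j (∷-noTwoVertical (φ r) j (φ-noTwoVertical o))

φ-hlen : ∀ {n p} → OddSM n p → hlen (φ p) ≡ n
φ-hlen ([_] {E} _) = refl
φ-hlen ([_] {U} _) = refl
φ-hlen ([_] {D} _) = refl
φ-hlen (cons {e = e} {f} {r} _ j o) =
  trans (hlen-modOdd-++ e (f ∷ φ r)) (cong₂ _+_ (InSM⇒dx≡1 j) (φ-hlen o))

φ∘ψ : ∀ q → φ (ψ q) ≡ q
φeven∘ψafter : ∀ q → φeven (ψafter q) ≡ q

φ∘ψ []       = refl
φ∘ψ (N ∷ q)  = cong (N ∷_) (φeven∘ψafter q)
φ∘ψ (S ∷ q)  = cong (S ∷_) (φeven∘ψafter q)
φ∘ψ (E ∷ q)  = φeven∘ψafter (E ∷ q)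
φ∘ψ (U ∷ q)  = φeven∘ψafter (U ∷ q)
φ∘ψ (D ∷ q)  = φeven∘ψafter (D ∷ q)

φeven∘ψafter []      = refl
φeven∘ψafter (s ∷ q) = cong (s ∷_) (φ∘ψ q)

ψ-modOdd-++ : ∀ {e f} r → InSM e → InSM f → ψ (modOdd e ++ f ∷ r) ≡ e ∷ f ∷ ψ r
ψ-modOdd-++ {E} {E} _ _ _ = refl
ψ-modOdd-++ {E} {U} _ _ _ = refl
ψ-modOdd-++ {E} {D} _ _ _ = refl
ψ-modOdd-++ {U}     _ _ _ = refl
ψ-modOdd-++ {D}     _ _ _ = refl

ψ∘φ : ∀ {n p} → OddSM n p → ψ (φ p) ≡ p
ψ∘φ ([_] {E} _) = refl
ψ∘φ ([_] {U} _) = refl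
ψ∘φ ([_] {D} _) = refl
ψ∘φ (cons {e = e} {f} {r} i j o) =
  trans (ψ-modOdd-++ (φ r) i j) (cong (λ p → e ∷ f ∷ p) (ψ∘φ o))

noTwoVertical-tail : ∀ {s} r → NoTwoVertical (s ∷ r) → NoTwoVertical r
noTwoVertical-tail []      _        = tt
noTwoVertical-tail (_ ∷ _) (_ , ntv) = ntv

cons-dx : ∀ {n e f r} → InSM e → InSM f → OddSM n r → OddSM (dx f + n) (e ∷ f ∷ r)
cons-dx {n} {e} {f} {r} i j o =
  subst (λ k → OddSM (k + n) (e ∷ f ∷ r)) (sym (InSM⇒dx≡1 j)) (cons i j o)

ψ-oddSM : ∀ q → NoTwoVertical q → OddSM (hlen q) (ψ q)
ψ-oddSM []          _           = [ tt ]
ψ-oddSM (N ∷ [])    _           = [ tt ]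
ψ-oddSM (S ∷ [])    _           = [ tt ]
ψ-oddSM (N ∷ f ∷ r) (¬vv , ntv) =
  cons-dx tt (¬IsVertical⇒InSM f (λ v → ¬vv (tt , v))) (ψ-oddSM r (noTwoVertical-tail r ntv))
ψ-oddSM (S ∷ f ∷ r) (¬vv , ntv) =
  cons-dx tt (¬IsVertical⇒InSM f (λ v → ¬vv (tt , v))) (ψ-oddSM r (noTwoVertical-tail r ntv))
ψ-oddSM (E ∷ r)     ntv         = cons tt tt (ψ-oddSM r (noTwoVertical-tail r ntv))
ψ-oddSM (U ∷ r)     ntv         = cons tt tt (ψ-oddSM r (noTwoVertical-tail r ntv))
ψ-oddSM (D ∷ r)     ntv         = cons tt tt (ψ-oddSM r (noTwoVertical-tail r ntv))

NonnegFrom-head : ∀ {h} ys → NonnegFrom h ys → + 0 ≤ℤ h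
NonnegFrom-head []      0≤h       = 0≤h
NonnegFrom-head (_ ∷ _) (0≤h , _) = 0≤h

E-∷-nonneg : ∀ {h} ys → NonnegFrom h ys → NonnegFrom h (E ∷ ys)
E-∷-nonneg {h} ys nn =
  NonnegFrom-head ys nn , subst (λ k → NonnegFrom k ys) (sym (+-identityʳ h)) nn

modOdd-++-nonneg : ∀ e {h ys} → + 0 ≤ℤ h → NonnegFrom (h +ℤ dy e) ys →
                   NonnegFrom h (modOdd e ++ ys)
modOdd-++-nonneg E {h} {ys} _ nn = subst (λ k → NonnegFrom k ys) (+-identityʳ h) nn
modOdd-++-nonneg U 0≤h nn = 0≤h , nn
modOdd-++-nonneg D 0≤h nn = 0≤h , nn
modOdd-++-nonneg N 0≤h nn = 0≤h , nn
modOdd-++-nonneg S 0≤h nn = 0≤h , nn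

φ-nonneg : ∀ {h} p → NonnegFrom h p → NonnegFrom h (φ p)
φeven-nonneg : ∀ {h} p → NonnegFrom h p → NonnegFrom h (φeven p)

φ-nonneg []       nn         = nn
φ-nonneg (e ∷ es) (0≤h , nn) = modOdd-++-nonneg e 0≤h (φeven-nonneg es nn)

φeven-nonneg []       nn         = nn
φeven-nonneg (_ ∷ es) (0≤h , nn) = 0≤h , φ-nonneg es nn

ψ-nonneg : ∀ {h} q → NonnegFrom h q → NonnegFrom h (ψ q)
ψafter-nonneg : ∀ {h} q → NonnegFrom h q → NonnegFrom h (ψafter q)

ψ-nonneg []      nn         = E-∷-nonneg [] nn
ψ-nonneg (N ∷ q) (0≤h , nn) = 0≤h , ψafter-nonneg q nn
ψ-nonneg (S ∷ q) (0≤h , nn) = 0≤h , ψafter-nonneg q nn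
ψ-nonneg (E ∷ q) nn         = E-∷-nonneg (ψafter (E ∷ q)) (ψafter-nonneg (E ∷ q) nn)
ψ-nonneg (U ∷ q) nn         = E-∷-nonneg (ψafter (U ∷ q)) (ψafter-nonneg (U ∷ q) nn)
ψ-nonneg (D ∷ q) nn         = E-∷-nonneg (ψafter (D ∷ q)) (ψafter-nonneg (D ∷ q) nn)

ψafter-nonneg []      nn         = nn
ψafter-nonneg (_ ∷ q) (0≤h , nn) = 0≤h , ψ-nonneg q nn

ψ-grandMotzkin : ∀ n q → AH n q → GrandMotzkin (2 * n + 1) (ψ q)
ψ-grandMotzkin _ q (ntv , refl) = oddSM⇒grandMotzkin (ψ-oddSM q ntv)

theorem7 : (n : ℕ) →
    ( ((p : Path) → Motzkin (2 * n + 1) p → AQ n (φ p))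
    × ((q : Path) → AQ n q → Motzkin (2 * n + 1) (ψ q))
    × ((p : Path) → Motzkin (2 * n + 1) p → ψ (φ p) ≡ p)
    × ((q : Path) → AQ n q → φ (ψ q) ≡ q) )
    ×
    ( ((p : Path) → GrandMotzkin (2 * n + 1) p → AH n (φ p))
    × ((q : Path) → AH n q → GrandMotzkin (2 * n + 1) (ψ q))
    × ((p : Path) → GrandMotzkin (2 * n + 1) p → ψ (φ p) ≡ p)
    × ((q : Path) → AH n q → φ (ψ q) ≡ q) )
theorem7 n =
  ( (λ p (g , nn) → φ-AH p g , φ-nonneg p nn)
  , (λ q (ah , nn) → ψ-grandMotzkin n q ah , ψ-nonneg q nn)
  , (λ p (g , _) → ψ∘φ (grandMotzkin⇒oddSM n p g))
  , (λ q _ → φ∘ψ q) )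
  ,
  ( φ-AH
  , ψ-grandMotzkin n
  , (λ p g → ψ∘φ (grandMotzkin⇒oddSM n p g))
  , (λ q _ → φ∘ψ q) )
  where
  φ-AH : ∀ p → GrandMotzkin (2 * n + 1) p → AH n (φ p)
  φ-AH p g = φ-noTwoVertical o , φ-hlen o
    where o = grandMotzkin⇒oddSM n p g
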